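{- Let $K^1$ and $K^2$ be complete graphs of orders $m\geq 3$ and $n\geq 3$, respectively. Then $\operatorname{dem}(K^1\Box K^2)=mn-\min\{m,n\}$.
   Context: For a graph $X$, a set $M\subseteq V(X)$ and an edge $e\in E(X)$, $P_X(M,e)$ is the set of pairs $(x,y)$ with $x\in M$, $y\in V(X)$ such that $d_X(x,y)\neq d_{X-e}(x,y)$. An edge $e$ is monitored by $x$ if $P_X(\{x\},e)\ne\emptyset$. A distance-edge-monitoring set is a set $M$ such that every edge is monitored by some vertex of $M$; $\operatorname{dem}(X)$ is the minimum size of such a set. $\Box$ denotes the Cartesian product of graphs. -}

module Defs where

open import Data.Nat using (ℕ; zero; suc; _*_; _≤_)
open import Data.Bool using (Bool; true; false; _∧_; _∨_; not; if_then_else_)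
open import Data.Fin using (Fin; remQuot)
open import Data.Fin.Properties using (_≟_)
open import Data.Fin.Subset using (Subset; _∈_; ∣_∣)
open import Data.Maybe using (Maybe; just; nothing)
open import Data.Product using (Σ; _×_; _,_; ∃; proj₁; proj₂)
open import Relation.Nullary.Decidable using (⌊_⌋)
open import Relation.Binary.PropositionalEquality using (_≡_; _≢_)

record Graph (n : ℕ) : Set where
  field
    adj : Fin n → Fin n → Bool
open Graph public

eqB : ∀ {n} → Fin n → Fin n → Bool
eqB i j = ⌊ i ≟ j ⌋

anyFin : ∀ n → (Fin n → Bool) → Bool
anyFin zero f = false
anyFin (suc n) f = f Fin.zero ∨ anyFin n (λ i → f (Fin.suc i))

K : ∀ m → Graph m
adj (K m) i j = not (eqB i j)

-- Cartesian product G □ H, vertex (a , b) ∈ Fin m × Fin n encoded in Fin (m * n)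
-- via remQuot (a bijection Fin (m * n) ≅ Fin m × Fin n).
_□_ : ∀ {m n} → Graph m → Graph n → Graph (m * n)
adj (_□_ {m} {n} G H) x y =
  let (a , b) = remQuot {m} n x
      (c , d) = remQuot {m} n y
  in (eqB a c ∧ adj H b d) ∨ (eqB b d ∧ adj G a c)

-- an edge: an ordered representative (u , v) of the unordered pair {u , v}
Edge : ∀ {n} → Graph n → Set
Edge {n} G = Σ (Fin n × Fin n) λ p → adj G (proj₁ p) (proj₂ p) ≡ true

_−_ : ∀ {n} (G : Graph n) → Edge G → Graph n
adj (G − ((u , v) , _)) i j =
  adj G i j ∧ not ((eqB i u ∧ eqB j v) ∨ (eqB i v ∧ eqB j u))

walk : ∀ {n} → Graph n → ℕ → Fin n → Fin n → Bool
walk G zero x y = eqB x y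
walk {n} G (suc k) x y = anyFin n (λ z → adj G x z ∧ walk G k z y)

search : ∀ {n} → Graph n → Fin n → Fin n → ℕ → ℕ → Maybe ℕ
search G x y i zero = nothing
search G x y i (suc fuel) =
  if walk G i x y then just i else search G x y (suc i) fuel

-- graph distance d_G(x , y): length of a shortest walk (= shortest path),
-- which if it exists is < n; nothing encodes distance ∞ (disconnected).
dist : ∀ {n} → Graph n → Fin n → Fin n → Maybe ℕ
dist {n} G x y = search G x y 0 n

Monitors : ∀ {n} (G : Graph n) → Fin n → Edge G → Set
Monitors {n} G x e = ∃ λ (y : Fin n) → dist G x y ≢ dist (G − e) x y

IsDEM : ∀ {n} → Graph n → Subset n → Set
IsDEM {n} G M = ∀ (e : Edge G) → ∃ λ (x : Fin n) → x ∈ M × Monitors G x e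

DemIs : ∀ {n} → Graph n → ℕ → Set
DemIs {n} G k = (∃ λ (M : Subset n) → IsDEM G M × ∣ M ∣ ≡ k)
              × (∀ (M : Subset n) → IsDEM G M → k ≤ ∣ M ∣)

{-# OPTIONS --safe #-}
-- In the rook graph K_m □ K_n two distinct non-adjacent vertices lie in
-- different rows and columns, so they have two distinct common neighbours
-- (the two remaining corners of their rectangle).  Deleting one edge uv can
-- destroy at most one of these two paths, and it does not touch the edges at
-- a vertex x ∉ {u, v}; hence no such x sees a distance change, while u and v
-- do.  So a set monitors every edge iff it is a vertex cover, i.e. iff its
-- complement is independent.  An independent set meets every row and every
-- column at most once, so it has at most min(m, n) vertices, and the diagonal
-- attains this bound.
module Submission where

open import Defs
open import Data.Nat using (ℕ; suc; _≤_; _*_; _∸_; _⊓_; z≤n; s≤s)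
open import Data.Nat.Properties
  using (≤-trans; ≤-antisym; <⇒≤; *-mono-≤; m≤m*n; ⊓-glb; m⊓n≤m; m⊓n≤n; ∸-monoʳ-≤; m∸[m∸n]≡n;
         module ≤-Reasoning)
  renaming (_≟_ to _≟ℕ_)
open import Data.Bool using (Bool; true; false; _∧_; _∨_; not)
open import Data.Bool.Properties using (∧-identityʳ; ∧-zeroʳ; ∨-zeroʳ; ¬-not; not-¬)
open import Data.Fin as Fin using (Fin; toℕ; inject≤; combine; remQuot)
open import Data.Fin.Properties
  using (_≟_; 0≢1+n; suc-injective; toℕ-injective; toℕ-inject≤;
         remQuot-combine; combine-remQuot; combine-injectiveˡ)
open import Data.Fin.Subset using (Subset; _∈_; ∣_∣; ∁; ⊤; _-_; inside; outside)
open import Data.Fin.Subset.Properties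
  using (_∈?_; ∈⊤; ∣⊤∣≡n; ∣p∣≤n; ∣∁p∣≡n∸∣p∣; x∈∁p⇒x∉p; x∉p⇒x∈∁p;
         x∈p⇒∣p-x∣<∣p∣; x∈p∧x≢y⇒x∈p-y)
open import Data.Vec using ([]; _∷_; tabulate; here; there)
open import Data.Vec.Properties using ([]=⇒lookup; lookup⇒[]=; lookup∘tabulate)
open import Data.Maybe using (just)
open import Data.Product using (_×_; _,_; ∃; ∃₂; proj₁; proj₂)
open import Data.Sum using (_⊎_; inj₁; inj₂)
open import Data.Empty using (⊥-elim)
open import Relation.Nullary using (Dec; yes; no; ¬_)
open import Relation.Nullary.Decidable using (⌊_⌋; isYes≗does; dec-true; dec-false; _×-dec_; _⊎-dec_)
open import Function using (case_of_)
open import Relation.Binary.Definitions using (Symmetric; Irreflexive)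
open import Relation.Binary.PropositionalEquality using (_≡_; _≢_; refl; sym; trans; cong; cong₂; subst; ≢-sym)

isYes-true : ∀ {a} {A : Set a} (a? : Dec A) → A → ⌊ a? ⌋ ≡ true
isYes-true a? a = trans (isYes≗does a?) (dec-true a? a)

isYes-false : ∀ {a} {A : Set a} (a? : Dec A) → ¬ A → ⌊ a? ⌋ ≡ false
isYes-false a? ¬a = trans (isYes≗does a?) (dec-false a? ¬a)

isYes⇒ : ∀ {a} {A : Set a} (a? : Dec A) → ⌊ a? ⌋ ≡ true → A
isYes⇒ (yes a) refl = a

isYes∧isYes≡false : ∀ {a b} {A : Set a} {B : Set b} (a? : Dec A) (b? : Dec B) →
  ¬ (A × B) → ⌊ a? ⌋ ∧ ⌊ b? ⌋ ≡ false
isYes∧isYes≡false (yes a) (yes b) ¬ab = ⊥-elim (¬ab (a , b))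
isYes∧isYes≡false (yes _) (no _)  _   = refl
isYes∧isYes≡false (no _)  _       _   = refl

∧≡true : ∀ {a b} → a ∧ b ≡ true → a ≡ true × b ≡ true
∧≡true {true} {true} refl = refl , refl

anyFin-intro : ∀ n (f : Fin n → Bool) i → f i ≡ true → anyFin n f ≡ true
anyFin-intro _ f Fin.zero fi rewrite fi = refl
anyFin-intro (suc n) f (Fin.suc i) fi
  rewrite anyFin-intro n (λ j → f (Fin.suc j)) i fi = ∨-zeroʳ (f Fin.zero)

anyFin-elim : ∀ n (f : Fin n → Bool) → anyFin n f ≡ true → ∃ λ i → f i ≡ true
anyFin-elim (suc n) f any with f Fin.zero in f0
... | true  = Fin.zero , f0
... | false with i , fi ← anyFin-elim n (λ j → f (Fin.suc j)) any = Fin.suc i , fi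

∈-tabulate⁺ : ∀ {n} {f : Fin n → Bool} {x} → f x ≡ true → x ∈ tabulate f
∈-tabulate⁺ {f = f} {x} fx = lookup⇒[]= x (tabulate f) (trans (lookup∘tabulate f x) fx)

∈-tabulate⁻ : ∀ {n} {f : Fin n → Bool} {x} → x ∈ tabulate f → f x ≡ true
∈-tabulate⁻ {f = f} {x} x∈ = trans (sym (lookup∘tabulate f x)) ([]=⇒lookup x∈)

injectiveOn⇒∣p∣≤∣q∣ : ∀ {s t} {p : Subset s} {q : Subset t} (f : Fin s → Fin t) →
  (∀ {x} → x ∈ p → f x ∈ q) →
  (∀ {x y} → x ∈ p → y ∈ p → f x ≡ f y → x ≡ y) →
  ∣ p ∣ ≤ ∣ q ∣
injectiveOn⇒∣p∣≤∣q∣ {p = []} f maps inj = z≤n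
injectiveOn⇒∣p∣≤∣q∣ {p = outside ∷ p} f maps inj =
  injectiveOn⇒∣p∣≤∣q∣ (λ x → f (Fin.suc x)) (λ x∈p → maps (there x∈p))
    (λ x∈p y∈p fx≡fy → suc-injective (inj (there x∈p) (there y∈p) fx≡fy))
injectiveOn⇒∣p∣≤∣q∣ {p = inside ∷ p} {q} f maps inj =
  ≤-trans (s≤s rest) (x∈p⇒∣p-x∣<∣p∣ (maps here))
  where
    rest : ∣ p ∣ ≤ ∣ q - f Fin.zero ∣
    rest = injectiveOn⇒∣p∣≤∣q∣ (λ x → f (Fin.suc x))
      (λ x∈p → x∈p∧x≢y⇒x∈p-y (maps (there x∈p))
                 (λ fx≡f0 → 0≢1+n (sym (inj (there x∈p) here fx≡f0))))
      (λ x∈p y∈p fx≡fy → suc-injective (inj (there x∈p) (there y∈p) fx≡fy))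

∣∁p∣≤k⇒n∸k≤∣p∣ : ∀ {n k} (p : Subset n) → ∣ ∁ p ∣ ≤ k → n ∸ k ≤ ∣ p ∣
∣∁p∣≤k⇒n∸k≤∣p∣ {n} {k} p ∣∁p∣≤k = begin
  n ∸ k           ≤⟨ ∸-monoʳ-≤ n ∣∁p∣≤k ⟩
  n ∸ ∣ ∁ p ∣     ≡⟨ cong (n ∸_) (∣∁p∣≡n∸∣p∣ p) ⟩
  n ∸ (n ∸ ∣ p ∣) ≡⟨ m∸[m∸n]≡n (∣p∣≤n p) ⟩
  ∣ p ∣           ∎
  where open ≤-Reasoning

k≤∣p∣⇒∣∁p∣≤n∸k : ∀ {n k} (p : Subset n) → k ≤ ∣ p ∣ → ∣ ∁ p ∣ ≤ n ∸ k
k≤∣p∣⇒∣∁p∣≤n∸k {n} p k≤∣p∣ =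
  subst (_≤ _) (sym (∣∁p∣≡n∸∣p∣ p)) (∸-monoʳ-≤ n k≤∣p∣)

Adj : ∀ {n} → Graph n → Fin n → Fin n → Set
Adj G x y = adj G x y ≡ true

CommonNeighbour : ∀ {n} → Graph n → Fin n → Fin n → Fin n → Set
CommonNeighbour G x y z = Adj G x z × Adj G z y

TwoCommonNeighbours : ∀ {n} → Graph n → Set
TwoCommonNeighbours {n} G = ∀ {x y : Fin n} → x ≢ y → ¬ Adj G x y →
  ∃₂ λ z z′ → z ≢ z′ × CommonNeighbour G x y z × CommonNeighbour G x y z′

Independent : ∀ {n} → Graph n → Subset n → Set
Independent G N = ∀ {x y} → x ∈ N → y ∈ N → ¬ Adj G x y

module _ {n} (G : Graph n) where

  walk₁≡adj : ∀ x y → walk G 1 x y ≡ adj G x y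
  walk₁≡adj x y with adj G x y in xy
  ... | true  = anyFin-intro n _ y (cong₂ _∧_ xy (isYes-true (y ≟ y) refl))
  ... | false = ¬-not λ w → not-¬ xy (walk₁⇒adj w)
    where
      walk₁⇒adj : walk G 1 x y ≡ true → adj G x y ≡ true
      walk₁⇒adj w
        with z , xz∧zy ← anyFin-elim n _ w
        with xz , zy ← ∧≡true {adj G x z} xz∧zy = subst (Adj G x) (isYes⇒ (z ≟ y) zy) xz

  walk₂-intro : ∀ {x z y} → CommonNeighbour G x y z → walk G 2 x y ≡ true
  walk₂-intro {x} {z} {y} (xz , zy) =
    anyFin-intro n _ z (cong₂ _∧_ xz (trans (walk₁≡adj z y) zy))

  search-sound : ∀ x y i fuel {k} → search G x y i fuel ≡ just k → walk G k x y ≡ true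
  search-sound x y i (suc fuel) found with walk G i x y in w
  search-sound x y i (suc fuel) refl | true = w
  ... | false = search-sound x y (suc i) fuel found

  dist≡1⇒adj : ∀ {x y} → dist G x y ≡ just 1 → Adj G x y
  dist≡1⇒adj {x} {y} d = trans (sym (walk₁≡adj x y)) (search-sound x y 0 n d)

dist-refl : ∀ {n} (G : Graph n) x → dist G x x ≡ just 0
dist-refl {suc n} G x rewrite isYes-true (x ≟ x) refl = refl

dist≡1 : ∀ {n} (G : Graph n) {x y} → 2 ≤ n → x ≢ y → Adj G x y → dist G x y ≡ just 1
dist≡1 G {x} {y} (s≤s (s≤s _)) x≢y xy
  rewrite isYes-false (x ≟ y) x≢y | walk₁≡adj G x y | xy = refl

dist≡2 : ∀ {n} (G : Graph n) {x y} → 3 ≤ n → x ≢ y → adj G x y ≡ false →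
  walk G 2 x y ≡ true → dist G x y ≡ just 2
dist≡2 G {x} {y} (s≤s (s≤s (s≤s _))) x≢y ¬xy w₂
  rewrite isYes-false (x ≟ y) x≢y | walk₁≡adj G x y | ¬xy | w₂ = refl

adjacent-monitors : ∀ {n} (G : Graph n) (e : Edge G) {x y} → 2 ≤ n → x ≢ y →
  Adj G x y → adj (G − e) x y ≡ false → Monitors G x e
adjacent-monitors G e 2≤n x≢y xy ¬xy′ =
  _ , λ d≡d′ → not-¬ ¬xy′ (dist≡1⇒adj (G − e) (trans (sym d≡d′) (dist≡1 G 2≤n x≢y xy)))

module EdgeDeletion {n} (G : Graph n) (e : Edge G) where

  u v : Fin n
  u = proj₁ (proj₁ e)
  v = proj₂ (proj₁ e)

  Deleted : Fin n → Fin n → Set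
  Deleted i j = (i ≡ u × j ≡ v) ⊎ (i ≡ v × j ≡ u)

  adj-−-deleted : ∀ {i j} → Deleted i j → adj (G − e) i j ≡ false
  adj-−-deleted (inj₁ (refl , refl))
    rewrite isYes-true (u ≟ u) refl | isYes-true (v ≟ v) refl = ∧-zeroʳ (adj G u v)
  adj-−-deleted (inj₂ (refl , refl))
    rewrite isYes-true (u ≟ u) refl | isYes-true (v ≟ v) refl
          | ∨-zeroʳ (⌊ v ≟ u ⌋ ∧ ⌊ u ≟ v ⌋) = ∧-zeroʳ (adj G v u)

  adj-−-kept : ∀ {i j} → Adj G i j → ¬ Deleted i j → Adj (G − e) i j
  adj-−-kept {i} {j} ij ¬deleted
    rewrite ij | isYes∧isYes≡false (i ≟ u) (j ≟ v) (λ d → ¬deleted (inj₁ d))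
             | isYes∧isYes≡false (i ≟ v) (j ≟ u) (λ d → ¬deleted (inj₂ d)) = refl

  adj-−-offEdge : ∀ {x} → x ≢ u → x ≢ v → ∀ z → adj (G − e) x z ≡ adj G x z
  adj-−-offEdge {x} x≢u x≢v z
    rewrite isYes-false (x ≟ u) x≢u | isYes-false (x ≟ v) x≢v = ∧-identityʳ (adj G x z)

  deleted? : ∀ i j → Dec (Deleted i j)
  deleted? i j = (i ≟ u ×-dec j ≟ v) ⊎-dec (i ≟ v ×-dec j ≟ u)

  deleted-unique : u ≢ v → ∀ {z z′ y} → Deleted z y → Deleted z′ y → z ≡ z′
  deleted-unique u≢v (inj₁ (refl , _))    (inj₁ (refl , _))    = refl
  deleted-unique u≢v (inj₂ (refl , _))    (inj₂ (refl , _))    = refl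
  deleted-unique u≢v (inj₁ (_ , refl))    (inj₂ (_ , y≡u))     = ⊥-elim (u≢v (sym y≡u))
  deleted-unique u≢v (inj₂ (_ , refl))    (inj₁ (_ , y≡v))     = ⊥-elim (u≢v y≡v)

  walk₂-−-via : ∀ {x y z} → x ≢ u → x ≢ v →
    CommonNeighbour G x y z → ¬ Deleted z y → walk (G − e) 2 x y ≡ true
  walk₂-−-via x≢u x≢v (xz , zy) ¬deleted =
    walk₂-intro (G − e) (trans (adj-−-offEdge x≢u x≢v _) xz , adj-−-kept zy ¬deleted)

  walk₂-− : u ≢ v → ∀ {x y z z′} → x ≢ u → x ≢ v → z ≢ z′ →
    CommonNeighbour G x y z → CommonNeighbour G x y z′ → walk (G − e) 2 x y ≡ true
  walk₂-− u≢v {y = y} {z} x≢u x≢v z≢z′ cz cz′ with deleted? z y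
  ... | no ¬deleted = walk₂-−-via x≢u x≢v cz ¬deleted
  ... | yes deleted = walk₂-−-via x≢u x≢v cz′
                        λ deleted′ → z≢z′ (deleted-unique u≢v deleted deleted′)

  module _ (irrefl : Irreflexive _≡_ (Adj G)) where

    u≢v : u ≢ v
    u≢v u≡v = irrefl u≡v (proj₂ e)

    source-monitors : 2 ≤ n → Monitors G u e
    source-monitors 2≤n =
      adjacent-monitors G e 2≤n u≢v (proj₂ e) (adj-−-deleted (inj₁ (refl , refl)))

    target-monitors : 2 ≤ n → Symmetric (Adj G) → Monitors G v e
    target-monitors 2≤n symm =
      adjacent-monitors G e 2≤n (≢-sym u≢v) (symm (proj₂ e)) (adj-−-deleted (inj₂ (refl , refl)))

    module _ (3≤n : 3 ≤ n) (two : TwoCommonNeighbours G) where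

      dist-−-offEdge : ∀ {x} → x ≢ u → x ≢ v → ∀ y → dist G x y ≡ dist (G − e) x y
      dist-−-offEdge {x} x≢u x≢v y with x ≟ y
      ... | yes refl = trans (dist-refl G x) (sym (dist-refl (G − e) x))
      ... | no x≢y with adj G x y in xy
      ... | true = trans (dist≡1 G (<⇒≤ 3≤n) x≢y xy)
                     (sym (dist≡1 (G − e) (<⇒≤ 3≤n) x≢y (trans (adj-−-offEdge x≢u x≢v y) xy)))
      ... | false with z , z′ , z≢z′ , cz , cz′ ← two x≢y (not-¬ xy) =
        trans (dist≡2 G 3≤n x≢y xy (walk₂-intro G cz))
              (sym (dist≡2 (G − e) 3≤n x≢y (trans (adj-−-offEdge x≢u x≢v y) xy)
                     (walk₂-− u≢v x≢u x≢v z≢z′ cz cz′)))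

      monitors⇒endpoint : ∀ {x} → Monitors G x e → x ≡ u ⊎ x ≡ v
      monitors⇒endpoint {x} (y , d≢d′) with x ≟ u | x ≟ v
      ... | yes x≡u | _       = inj₁ x≡u
      ... | no _    | yes x≡v = inj₂ x≡v
      ... | no x≢u  | no x≢v  = ⊥-elim (d≢d′ (dist-−-offEdge x≢u x≢v y))

DEM⇒∁-independent : ∀ {n} (G : Graph n) → 3 ≤ n → Irreflexive _≡_ (Adj G) →
  TwoCommonNeighbours G → ∀ {M} → IsDEM G M → Independent G (∁ M)
DEM⇒∁-independent G 3≤n irrefl two dem {x} {y} x∈∁M y∈∁M xy
  with z , z∈M , z-monitors ← dem ((x , y) , xy)
  with EdgeDeletion.monitors⇒endpoint G ((x , y) , xy) irrefl 3≤n two z-monitors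
... | inj₁ refl = x∈∁p⇒x∉p x∈∁M z∈M
... | inj₂ refl = x∈∁p⇒x∉p y∈∁M z∈M

independent⇒∁-DEM : ∀ {n} (G : Graph n) → 2 ≤ n → Irreflexive _≡_ (Adj G) →
  Symmetric (Adj G) → ∀ {N} → Independent G N → IsDEM G (∁ N)
independent⇒∁-DEM G 2≤n irrefl symm {N} indep e@((u , v) , uv) with u ∈? N
... | no u∉N  = u , x∉p⇒x∈∁p u∉N , EdgeDeletion.source-monitors G e irrefl 2≤n
... | yes u∈N = v , x∉p⇒x∈∁p (λ v∈N → indep u∈N v∈N uv) ,
  EdgeDeletion.target-monitors G e irrefl 2≤n symm

module RookGraph (m n : ℕ) where

  Rook : Graph (m * n)
  Rook = K m □ K n

  row : Fin (m * n) → Fin m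
  row x = proj₁ (remQuot {m} n x)

  col : Fin (m * n) → Fin n
  col x = proj₂ (remQuot {m} n x)

  row-combine : ∀ (a : Fin m) (b : Fin n) → row (combine a b) ≡ a
  row-combine a b = cong proj₁ (remQuot-combine a b)

  col-combine : ∀ (a : Fin m) (b : Fin n) → col (combine a b) ≡ b
  col-combine a b = cong proj₂ (remQuot-combine a b)

  row-col-injective : ∀ {x y} → row x ≡ row y → col x ≡ col y → x ≡ y
  row-col-injective {x} {y} r c = trans (sym (combine-remQuot {m} n x))
    (trans (cong₂ combine r c) (combine-remQuot {m} n y))

  adj-sameRow : ∀ {x y} → row x ≡ row y → col x ≢ col y → Adj Rook x y
  adj-sameRow {x} {y} r c
    rewrite isYes-true (row x ≟ row y) r | isYes-false (col x ≟ col y) c = refl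

  adj-sameCol : ∀ {x y} → col x ≡ col y → row x ≢ row y → Adj Rook x y
  adj-sameCol {x} {y} c r
    rewrite isYes-true (col x ≟ col y) c | isYes-false (row x ≟ row y) r = refl

  adj-elim : ∀ {x y} → Adj Rook x y →
    (row x ≡ row y × col x ≢ col y) ⊎ (col x ≡ col y × row x ≢ row y)
  adj-elim {x} {y} xy with row x ≟ row y | col x ≟ col y
  ... | yes r | no c  = inj₁ (r , c)
  ... | no r  | yes c = inj₂ (c , r)

  rook-irreflexive : Irreflexive _≡_ (Adj Rook)
  rook-irreflexive refl xx with adj-elim xx
  ... | inj₁ (_ , c≢c) = c≢c refl
  ... | inj₂ (_ , r≢r) = r≢r refl

  rook-symmetric : Symmetric (Adj Rook)
  rook-symmetric xy with adj-elim xy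
  ... | inj₁ (r , c≢) = adj-sameRow (sym r) (≢-sym c≢)
  ... | inj₂ (c , r≢) = adj-sameCol (sym c) (≢-sym r≢)

  nonadjacent⇒differentLines : ∀ {x y} → x ≢ y → ¬ Adj Rook x y → row x ≢ row y × col x ≢ col y
  nonadjacent⇒differentLines {x} {y} x≢y ¬xy = differentRows , differentCols
    where
      differentRows : row x ≢ row y
      differentRows r = case col x ≟ col y of λ where
        (yes c) → x≢y (row-col-injective r c)
        (no c)  → ¬xy (adj-sameRow r c)
      differentCols : col x ≢ col y
      differentCols c = case row x ≟ row y of λ where
        (yes r) → x≢y (row-col-injective r c)
        (no r)  → ¬xy (adj-sameCol c r)

  rook-twoCommonNeighbours : TwoCommonNeighbours Rook
  rook-twoCommonNeighbours {x} {y} x≢y ¬xy =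
    combine (row x) (col y) , combine (row y) (col x) , corners-differ ,
    (adj-sameRow (sym (row-combine _ _)) (λ c → c≢ (trans c (col-combine _ _))) ,
     adj-sameCol (col-combine _ _) (λ r → r≢ (trans (sym (row-combine _ _)) r))) ,
    (adj-sameCol (sym (col-combine _ _)) (λ r → r≢ (trans r (row-combine _ _))) ,
     adj-sameRow (row-combine _ _) (λ c → c≢ (trans (sym (col-combine _ _)) c)))
    where
      r≢ = proj₁ (nonadjacent⇒differentLines x≢y ¬xy)
      c≢ = proj₂ (nonadjacent⇒differentLines x≢y ¬xy)
      corners-differ : combine (row x) (col y) ≢ combine (row y) (col x)
      corners-differ eq = r≢ (combine-injectiveˡ (row x) (col y) (row y) (col x) eq)

  ∣independent∣≤m⊓n : ∀ {N} → Independent Rook N → ∣ N ∣ ≤ m ⊓ n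
  ∣independent∣≤m⊓n {N} indep = ⊓-glb
    (subst (∣ N ∣ ≤_) (∣⊤∣≡n m) (injectiveOn⇒∣p∣≤∣q∣ row (λ _ → ∈⊤) rowInjective))
    (subst (∣ N ∣ ≤_) (∣⊤∣≡n n) (injectiveOn⇒∣p∣≤∣q∣ col (λ _ → ∈⊤) colInjective))
    where
      rowInjective : ∀ {x y} → x ∈ N → y ∈ N → row x ≡ row y → x ≡ y
      rowInjective {x} {y} x∈N y∈N r with col x ≟ col y
      ... | yes c = row-col-injective r c
      ... | no c  = ⊥-elim (indep x∈N y∈N (adj-sameRow r c))
      colInjective : ∀ {x y} → x ∈ N → y ∈ N → col x ≡ col y → x ≡ y
      colInjective {x} {y} x∈N y∈N c with row x ≟ row y
      ... | yes r = row-col-injective r c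
      ... | no r  = ⊥-elim (indep x∈N y∈N (adj-sameCol c r))

  diagonal : Subset (m * n)
  diagonal = tabulate λ x → ⌊ toℕ (row x) ≟ℕ toℕ (col x) ⌋

  ∈diagonal⇒ : ∀ {x} → x ∈ diagonal → toℕ (row x) ≡ toℕ (col x)
  ∈diagonal⇒ {x} x∈D = isYes⇒ (toℕ (row x) ≟ℕ toℕ (col x)) (∈-tabulate⁻ x∈D)

  diagonal-independent : Independent Rook diagonal
  diagonal-independent {x} {y} x∈D y∈D xy with adj-elim xy
  ... | inj₁ (r , c≢) = c≢ (toℕ-injective
          (trans (sym (∈diagonal⇒ x∈D)) (trans (cong toℕ r) (∈diagonal⇒ y∈D))))
  ... | inj₂ (c , r≢) = r≢ (toℕ-injective
          (trans (∈diagonal⇒ x∈D) (trans (cong toℕ c) (sym (∈diagonal⇒ y∈D)))))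

  m⊓n≤∣diagonal∣ : m ⊓ n ≤ ∣ diagonal ∣
  m⊓n≤∣diagonal∣ = subst (_≤ ∣ diagonal ∣) (∣⊤∣≡n (m ⊓ n))
    (injectiveOn⇒∣p∣≤∣q∣ square
      (λ {i} _ → ∈-tabulate⁺ (isYes-true (_ ≟ℕ _) (square-onDiagonal i)))
      square-injective)
    where
      square : Fin (m ⊓ n) → Fin (m * n)
      square i = combine (inject≤ i (m⊓n≤m m n)) (inject≤ i (m⊓n≤n m n))
      square-onDiagonal : ∀ i → toℕ (row (square i)) ≡ toℕ (col (square i))
      square-onDiagonal i = trans (cong toℕ (row-combine _ _)) (trans (toℕ-inject≤ i _)
        (sym (trans (cong toℕ (col-combine _ _)) (toℕ-inject≤ i _))))
      square-injective : ∀ {i j} → i ∈ ⊤ → j ∈ ⊤ → square i ≡ square j → i ≡ j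
      square-injective {i} {j} _ _ eq = toℕ-injective (trans (sym (toℕ-inject≤ i (m⊓n≤m m n)))
        (trans (cong toℕ (combine-injectiveˡ _ _ _ _ eq)) (toℕ-inject≤ j (m⊓n≤m m n))))

  ∣∁diagonal∣≤mn∸m⊓n : ∣ ∁ diagonal ∣ ≤ m * n ∸ m ⊓ n
  ∣∁diagonal∣≤mn∸m⊓n = k≤∣p∣⇒∣∁p∣≤n∸k diagonal m⊓n≤∣diagonal∣

  module _ (3≤mn : 3 ≤ m * n) where

    dem-lowerBound : ∀ M → IsDEM Rook M → m * n ∸ m ⊓ n ≤ ∣ M ∣
    dem-lowerBound M dem = ∣∁p∣≤k⇒n∸k≤∣p∣ M (∣independent∣≤m⊓n
      (DEM⇒∁-independent Rook 3≤mn rook-irreflexive rook-twoCommonNeighbours dem))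

    ∁diagonal-DEM : IsDEM Rook (∁ diagonal)
    ∁diagonal-DEM =
      independent⇒∁-DEM Rook (<⇒≤ 3≤mn) rook-irreflexive rook-symmetric diagonal-independent

mainTheorem16 : ∀ (m n : ℕ) → 3 ≤ m → 3 ≤ n →
    DemIs (K m □ K n) (m * n ∸ (m ⊓ n))
mainTheorem16 m n 3≤m 3≤n =
  (∁ diagonal , ∁diagonal-DEM 3≤mn ,
   ≤-antisym ∣∁diagonal∣≤mn∸m⊓n (dem-lowerBound 3≤mn _ (∁diagonal-DEM 3≤mn))) ,
  dem-lowerBound 3≤mn
  where
    open RookGraph m n
    3≤mn : 3 ≤ m * n
    3≤mn = ≤-trans (m≤m*n 3 3) (*-mono-≤ 3≤m 3≤n)
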